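{- For every finite multigraph $G$, $$\theta_G(\beta,0)=(1-\beta)^{n(G)}\beta^{r(G)}\,T_G\Big(\frac1\beta,\frac{1+\beta}{1-\beta}\Big)$$ as rational functions of $\beta$.
   Context: Loops count $2$ towards degrees. $f_0=1,f_1=0,f_{n+1}(x)=xf_n(x)+f_{n-1}(x)$; $\theta_G(\beta,\gamma)=\sum_{s\subset E}\beta^{|s|}\prod_{i\in V}f_{d_i(s)}(\gamma)$ with $d_i(s)$ the degree of $i$ in the spanning subgraph $(V,s)$. For $s\subset E$ let $k(s)$ be the number of components of $(V,s)$, $r(s)=|V|-k(s)$, $n(s)=|s|-|V|+k(s)$; $r(G)=r(E)$, $n(G)=n(E)$. Tutte polynomial: $T_G(x,y)=\sum_{s\subset E}(x-1)^{r(G)-r(s)}(y-1)^{n(s)}$. -}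

module Defs where

open import Data.Nat as ℕ using (ℕ; zero; suc)
open import Data.Fin using (Fin; zero; suc; _≟_)
open import Data.Bool using (Bool; true; false; _∨_; _∧_; if_then_else_; not)
open import Data.Vec using (Vec; []; _∷_; lookup)
open import Data.List using (List; []; _∷_; map; _++_; foldr)
open import Data.Product using (_×_; _,_; proj₁; proj₂)
open import Relation.Nullary.Decidable using (⌊_⌋)
open import Data.Rational using (ℚ; 0ℚ; 1ℚ; _+_; _*_; _-_)

-- A finite multigraph: vertex set Fin n, edge set Fin m, each edge with
-- two (unordered) endpoints.  Loops (equal endpoints) and parallel
-- edges are allowed.
record Multigraph : Set where
  field
    nV   : ℕ
    nE   : ℕ
    ends : Fin nE → Fin nV × Fin nV
open Multigraph public

EdgeSet : Multigraph → Set
EdgeSet G = Vec Bool (nE G)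

allSubsets : (m : ℕ) → List (Vec Bool m)
allSubsets zero    = [] ∷ []
allSubsets (suc m) = map (true ∷_) (allSubsets m) ++ map (false ∷_) (allSubsets m)

sumℚ : List ℚ → ℚ
sumℚ = foldr _+_ 0ℚ

sumFinℕ : (m : ℕ) → (Fin m → ℕ) → ℕ
sumFinℕ zero    f = 0
sumFinℕ (suc m) f = f zero ℕ.+ sumFinℕ m (λ i → f (suc i))

anyFin : (m : ℕ) → (Fin m → Bool) → Bool
anyFin zero    f = false
anyFin (suc m) f = f zero ∨ anyFin m (λ i → f (suc i))

card : {m : ℕ} → Vec Bool m → ℕ
card []          = 0
card (true ∷ s)  = suc (card s)
card (false ∷ s) = card s

infixr 8 _^_
_^_ : ℚ → ℕ → ℚ
x ^ zero  = 1ℚ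
x ^ suc k = x * (x ^ k)

eqb : {n : ℕ} → Fin n → Fin n → Bool
eqb i j = ⌊ i ≟ j ⌋

bit : Bool → ℕ
bit true  = 1
bit false = 0

-- degree of vertex i in the spanning subgraph (V,s); a loop counts 2
degree : (G : Multigraph) → EdgeSet G → Fin (nV G) → ℕ
degree G s i = sumFinℕ (nE G) λ e →
  if lookup s e
  then bit (eqb (proj₁ (ends G e)) i) ℕ.+ bit (eqb (proj₂ (ends G e)) i)
  else 0

f : ℕ → ℚ → ℚ
f zero          x = 1ℚ
f (suc zero)    x = 0ℚ
f (suc (suc k)) x = x * f (suc k) x + f k x

prodFinℚ : (m : ℕ) → (Fin m → ℚ) → ℚ
prodFinℚ zero    g = 1ℚ
prodFinℚ (suc m) g = g zero * prodFinℚ m (λ i → g (suc i))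

θ : Multigraph → ℚ → ℚ → ℚ
θ G β γ = sumℚ (map (λ s → (β ^ card s) * prodFinℚ (nV G) (λ i → f (degree G s i) γ))
                    (allSubsets (nE G)))

-- Connectivity in (V,s): reach t i j holds iff j is joined to i by a
-- walk of length ≤ t using edges of s.
adjacent : (G : Multigraph) → EdgeSet G → Fin (nV G) → Fin (nV G) → Bool
adjacent G s a b = anyFin (nE G) λ e →
  lookup s e ∧ ((eqb (proj₁ (ends G e)) a ∧ eqb (proj₂ (ends G e)) b)
             ∨ (eqb (proj₁ (ends G e)) b ∧ eqb (proj₂ (ends G e)) a))

reach : (G : Multigraph) → EdgeSet G → ℕ → Fin (nV G) → Fin (nV G) → Bool
reach G s zero    i j = eqb i j
reach G s (suc t) i j = reach G s t i j ∨
  anyFin (nV G) (λ a → reach G s t i a ∧ adjacent G s a j)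

-- i and j lie in the same component of (V,s) (walks of length ≤ |V| suffice)
connected : (G : Multigraph) → EdgeSet G → Fin (nV G) → Fin (nV G) → Bool
connected G s = reach G s (nV G)

-- k(s): number of components of (V,s), counted as the number of
-- vertices that are the least (in Fin order) vertex of their component.
isLeast : (G : Multigraph) → EdgeSet G → Fin (nV G) → Bool
isLeast G s i = not (anyFin (nV G) λ j → ⌊ j Data.Fin.<? i ⌋ ∧ connected G s i j)

k : (G : Multigraph) → EdgeSet G → ℕ
k G s = sumFinℕ (nV G) λ i → bit (isLeast G s i)

-- r(s) = |V| - k(s),  n(s) = |s| - |V| + k(s)   (both are ≥ 0)
rk : (G : Multigraph) → EdgeSet G → ℕ
rk G s = nV G ℕ.∸ k G s

nul : (G : Multigraph) → EdgeSet G → ℕ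
nul G s = (card s ℕ.+ k G s) ℕ.∸ nV G

allE : (G : Multigraph) → EdgeSet G
allE G = Data.Vec.replicate (nE G) true

rG : Multigraph → ℕ
rG G = rk G (allE G)

nG : Multigraph → ℕ
nG G = nul G (allE G)

T : Multigraph → ℚ → ℚ → ℚ
T G x y = sumℚ (map (λ s → ((x - 1ℚ) ^ (rG G ℕ.∸ rk G s)) * ((y - 1ℚ) ^ nul G s))
                    (allSubsets (nE G)))

-- Since f_d(0) is 1 for even d and 0 for odd d, θ_G(β,0) = Σ β^|t| over the even spanning
-- subgraphs t.  Writing β^|t| = Σ_{s ⊇ t} β^|s| (1-β)^|E∖s| and exchanging the sums gives
-- θ_G(β,0) = Σ_s β^|s| (1-β)^|E∖s| ε(s), where ε(s) counts the even subgraphs of s.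
-- Adding an edge e to s either joins two components, and then no even subgraph of s + e
-- contains e (e alone crosses the cut around a component, which even subgraphs cross an even
-- number of times), or it closes a cycle C, and then t ↦ t △ C pairs the even subgraphs
-- containing e with those avoiding it.  Hence ε(s) = 2^n(s).  Since β(1/β - 1) = 1 - β and
-- (1-β)((1+β)/(1-β) - 1) = 2β, the term of s then equals (1-β)^n(G) β^r(G) times the term of s
-- in the subset expansion of T_G.

module Submission where

open import Defs
open import Algebra.Bundles using (CommutativeRing; CommutativeMonoid)
import Algebra.Properties.Semiring.Sum as SemiringSum
open import Data.Bool using (Bool; true; false; _∨_; _∧_; not; _xor_; if_then_else_)
import Data.Bool.Properties as BP
open import Data.Empty using (⊥; ⊥-elim)
open import Data.Fin as F using (Fin; zero; suc)
import Data.Fin.Properties as FP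
open import Data.Nat as ℕ using (ℕ; zero; suc; _≤_; _∸_; z≤n; s≤s)
open import Data.Nat.Tactic.RingSolver using (solve-∀)
import Data.Nat.Properties as ℕP
open import Data.Product using (∃; _×_; _,_; proj₁; proj₂)
import Data.Vec as Vec
open import Data.Vec using (Vec; []; _∷_; lookup; replicate; zipWith; tabulate; _[_]≔_)
import Data.Vec.Properties as VP
open import Data.List using (List; []; _∷_; map; _++_)
import Data.List.Properties as LP
open import Data.Rational using (ℚ; 0ℚ; 1ℚ; _+_; _*_; _-_; NonZero; 1/_; _÷_)
import Data.Rational.Properties as QP
open import Algebra.Properties.CommutativeSemigroup (CommutativeMonoid.commutativeSemigroup QP.+-0-commutativeMonoid)
  using () renaming (interchange to +-interchange)
open import Level using (0ℓ)
import Tactic.RingSolver as ℚ-Solver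
open import Tactic.RingSolver.Core.AlmostCommutativeRing using (AlmostCommutativeRing; fromCommutativeRing)
open import Data.Sum using (_⊎_; inj₁; inj₂)
open import Function using (_∘_)
open import Relation.Binary.PropositionalEquality
open import Relation.Binary.Structures using (IsEquivalence)
open import Relation.Binary.Definitions using (tri<; tri≈; tri>)
open import Relation.Nullary using (yes; no)
open import Relation.Binary.Construct.Closure.Equivalence as EqClosure using (EqClosure)
open import Relation.Binary.Construct.Closure.ReflexiveTransitive as Star using (ε; _◅◅_)
open import Relation.Binary.Construct.Closure.Symmetric using (SymClosure; fwd; bwd)
open import Relation.Nullary.Decidable using (⌊_⌋; dec⇒maybe; isYes≗does; dec-true; dec-false)

∧-true⁻ : ∀ {a b} → a ∧ b ≡ true → a ≡ true × b ≡ true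
∧-true⁻ {true} p = refl , p

∧-true : ∀ {a b} → a ≡ true → b ≡ true → a ∧ b ≡ true
∧-true refl refl = refl

∨-true⁻ : ∀ {a b} → a ∨ b ≡ true → a ≡ true ⊎ b ≡ true
∨-true⁻ {true} p = inj₁ refl
∨-true⁻ {false} p = inj₂ p

∨-trueˡ : ∀ {a} b → a ≡ true → a ∨ b ≡ true
∨-trueˡ b refl = refl

∨-trueʳ : ∀ a {b} → b ≡ true → a ∨ b ≡ true
∨-trueʳ true p = refl
∨-trueʳ false p = p

true≢false : ∀ {b} → b ≡ true → b ≡ false → ⊥
true≢false refl ()

bool-ext : ∀ {b c : Bool} → (b ≡ true → c ≡ true) → (c ≡ true → b ≡ true) → b ≡ c
bool-ext {true} p q = sym (p refl)
bool-ext {false} {true} p q = q refl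
bool-ext {false} {false} p q = refl

eqb-refl : ∀ {n} (i : Fin n) → eqb i i ≡ true
eqb-refl i = trans (isYes≗does (i F.≟ i)) (dec-true (i F.≟ i) refl)

eqb-≢ : ∀ {n} {i j : Fin n} → i ≢ j → eqb i j ≡ false
eqb-≢ {i = i} {j} i≢j = trans (isYes≗does (i F.≟ j)) (dec-false (i F.≟ j) i≢j)

eqb-≡ : ∀ {n} {i j : Fin n} → eqb i j ≡ true → i ≡ j
eqb-≡ {i = i} {j} p with i F.≟ j
... | yes i≡j = i≡j

anyFin-intro : ∀ {m} (g : Fin m → Bool) (i : Fin m) → g i ≡ true → anyFin m g ≡ true
anyFin-intro g zero p = ∨-trueˡ _ p
anyFin-intro g (suc i) p = ∨-trueʳ (g zero) (anyFin-intro (g ∘ suc) i p)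

anyFin-elim : ∀ {m} (g : Fin m → Bool) → anyFin m g ≡ true → ∃ λ i → g i ≡ true
anyFin-elim {suc m} g p with ∨-true⁻ {g zero} p
... | inj₁ q = zero , q
... | inj₂ q with anyFin-elim (g ∘ suc) q
...   | i , r = suc i , r

anyFin-false : ∀ {m} (g : Fin m → Bool) → (∀ i → g i ≡ false) → anyFin m g ≡ false
anyFin-false g h = BP.¬-not λ p → let i , q = anyFin-elim g p in true≢false q (h i)

anyFin-cong : ∀ {m} {g h : Fin m → Bool} → (∀ i → g i ≡ h i) → anyFin m g ≡ anyFin m h
anyFin-cong {zero} e = refl
anyFin-cong {suc m} e = cong₂ _∨_ (e zero) (anyFin-cong (e ∘ suc))

sumFinℕ-cong : ∀ {m} {g h : Fin m → ℕ} → (∀ i → g i ≡ h i) → sumFinℕ m g ≡ sumFinℕ m h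
sumFinℕ-cong {zero} e = refl
sumFinℕ-cong {suc m} e = cong₂ ℕ._+_ (e zero) (sumFinℕ-cong (e ∘ suc))

count : ∀ {m} → (Fin m → Bool) → ℕ
count {m} g = sumFinℕ m (bit ∘ g)

count-≤ : ∀ {m} (g : Fin m → Bool) → count g ≤ m
count-≤ {zero} g = z≤n
count-≤ {suc m} g with g zero
... | true = s≤s (count-≤ (g ∘ suc))
... | false = ℕP.m≤n⇒m≤1+n (count-≤ (g ∘ suc))

count-all : ∀ {m} (g : Fin m → Bool) → (∀ i → g i ≡ true) → count g ≡ m
count-all {zero} g h = refl
count-all {suc m} g h rewrite h zero = cong suc (count-all (g ∘ suc) (h ∘ suc))

bit-mono : ∀ {a b} → (a ≡ true → b ≡ true) → bit a ≤ bit b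
bit-mono {true} h rewrite h refl = ℕP.≤-refl
bit-mono {false} h = z≤n

count-mono : ∀ {m} {g h : Fin m → Bool} → (∀ i → g i ≡ true → h i ≡ true) → count g ≤ count h
count-mono {zero} gh = z≤n
count-mono {suc m} gh = ℕP.+-mono-≤ (bit-mono (gh zero)) (count-mono (gh ∘ suc))

count-< : ∀ {m} {g h : Fin m → Bool} (p : Fin m) → (∀ i → g i ≡ true → h i ≡ true) →
          g p ≡ false → h p ≡ true → suc (count g) ≤ count h
count-< {g = g} {h} zero gh gp hp rewrite gp | hp = s≤s (count-mono (gh ∘ suc))
count-< {g = g} {h} (suc p) gh gp hp =
  ℕP.≤-trans (ℕP.≤-reflexive (sym (ℕP.+-suc (bit (g zero)) _)))
             (ℕP.+-mono-≤ (bit-mono (gh zero)) (count-< p (gh ∘ suc) gp hp))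

count-drop : ∀ {m} {g h : Fin m → Bool} (p : Fin m) → g p ≡ true → h p ≡ false →
             (∀ i → i ≢ p → h i ≡ g i) → count g ≡ suc (count h)
count-drop {g = g} {h} zero gp hp hg rewrite gp | hp =
  cong suc (sumFinℕ-cong λ i → cong bit (sym (hg (suc i) λ ())))
count-drop {g = g} {h} (suc p) gp hp hg rewrite hg zero (λ ()) =
  trans (cong (bit (g zero) ℕ.+_) (count-drop p gp hp λ i i≢p → hg (suc i) (i≢p ∘ FP.suc-injective)))
        (ℕP.+-suc (bit (g zero)) _)

module ⊕ = SemiringSum (CommutativeRing.semiring BP.xor-∧-commutativeRing)

⊕-sum-false : ∀ {m} (g : Fin m → Bool) → (∀ i → g i ≡ false) → ⊕.sum g ≡ false
⊕-sum-false {m} g h = trans (⊕.sum-cong-≗ h) (⊕.sum-replicate-zero m)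

⊕-single : ∀ {m} (p : Fin m) (g : Fin m → Bool) → (∀ i → i ≢ p → g i ≡ false) → ⊕.sum g ≡ g p
⊕-single {suc m} zero g others =
  trans (cong (g zero xor_) (⊕-sum-false {m} (g ∘ suc) λ i → others (suc i) λ ()))
        (BP.xor-identityʳ (g zero))
⊕-single {suc m} (suc p) g others rewrite others zero (λ ()) =
  ⊕-single p (g ∘ suc) λ i i≢p → others (suc i) (i≢p ∘ FP.suc-injective)

⊕-select : ∀ {m} (p : Fin m) (g : Fin m → Bool) → ⊕.sum (λ i → eqb p i ∧ g i) ≡ g p
⊕-select p g = trans (⊕-single p _ λ i i≢p → cong (_∧ g i) (eqb-≢ (i≢p ∘ sym)))
                     (cong (_∧ g p) (eqb-refl p))

odd : ℕ → Bool
odd zero = false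
odd (suc n) = not (odd n)

odd-+ : ∀ m n → odd (m ℕ.+ n) ≡ odd m xor odd n
odd-+ zero n = refl
odd-+ (suc m) n = trans (cong not (odd-+ m n)) (BP.not-distribˡ-xor (odd m) (odd n))

odd-sumFinℕ : ∀ {m} (g : Fin m → ℕ) → odd (sumFinℕ m g) ≡ ⊕.sum (odd ∘ g)
odd-sumFinℕ {zero} g = refl
odd-sumFinℕ {suc m} g = trans (odd-+ (g zero) _) (cong (odd (g zero) xor_) (odd-sumFinℕ (g ∘ suc)))

xor-cancel-middle : ∀ a b c → (a xor b) xor (b xor c) ≡ a xor c
xor-cancel-middle a b c = trans (BP.xor-assoc a b (b xor c))
  (cong (a xor_) (trans (sym (BP.xor-assoc b b c)) (cong (_xor c) (BP.xor-same b))))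

-- Edge sets as Boolean vectors

infix 4 _⊆_
infixl 8 _△_

_⊆_ : ∀ {m} → Vec Bool m → Vec Bool m → Set
t ⊆ s = ∀ e → lookup t e ≡ true → lookup s e ≡ true

_△_ : ∀ {m} → Vec Bool m → Vec Bool m → Vec Bool m
_△_ = zipWith _xor_

lookup-△ : ∀ {m} (t c : Vec Bool m) e → lookup (t △ c) e ≡ lookup t e xor lookup c e
lookup-△ t c e = VP.lookup-zipWith _xor_ e t c

singleton : ∀ {m} → Fin m → Vec Bool m
singleton e = tabulate (eqb e)

singleton-⊆ : ∀ {m} {s : Vec Bool m} {e} → lookup s e ≡ true → singleton e ⊆ s
singleton-⊆ {e = e} se f p with eqb-≡ (trans (sym (VP.lookup∘tabulate (eqb e) f)) p)
... | refl = se

infix 7 _⊆ᵇ_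

_⊆ᵇ_ : ∀ {m} → Vec Bool m → Vec Bool m → Bool
[] ⊆ᵇ [] = true
(x ∷ t) ⊆ᵇ (y ∷ s) = (not x ∨ y) ∧ (t ⊆ᵇ s)

⊆ᵇ-true⁻ : ∀ {m} (t s : Vec Bool m) → t ⊆ᵇ s ≡ true → t ⊆ s
⊆ᵇ-true⁻ (true ∷ t) (true ∷ s) p zero q = refl
⊆ᵇ-true⁻ (x ∷ t) (y ∷ s) p (suc e) q = ⊆ᵇ-true⁻ t s (proj₂ (∧-true⁻ {not x ∨ y} p)) e q

⊆ᵇ-true : ∀ {m} (t s : Vec Bool m) → t ⊆ s → t ⊆ᵇ s ≡ true
⊆ᵇ-true [] [] t⊆s = refl
⊆ᵇ-true (true ∷ t) (y ∷ s) t⊆s rewrite t⊆s zero refl = ⊆ᵇ-true t s (t⊆s ∘ suc)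
⊆ᵇ-true (false ∷ t) (y ∷ s) t⊆s = ⊆ᵇ-true t s (t⊆s ∘ suc)

⊆ᵇ-cong : ∀ {m} (t s t′ s′ : Vec Bool m) → (t ⊆ s → t′ ⊆ s′) → (t′ ⊆ s′ → t ⊆ s) →
          t ⊆ᵇ s ≡ t′ ⊆ᵇ s′
⊆ᵇ-cong t s t′ s′ to from = bool-ext (λ p → ⊆ᵇ-true t′ s′ (to (⊆ᵇ-true⁻ t s p)))
                                     (λ p → ⊆ᵇ-true t s (from (⊆ᵇ-true⁻ t′ s′ p)))

△-⊆ : ∀ {m} (t c : Vec Bool m) {s} → t ⊆ s → c ⊆ s → t △ c ⊆ s
△-⊆ t c t⊆s c⊆s e p with lookup t e in te
... | true = t⊆s e te
... | false = c⊆s e (trans (sym (cong (_xor lookup c e) te)) (trans (sym (lookup-△ t c e)) p))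

lookup-△-△ : ∀ {m} (t c : Vec Bool m) e → lookup (t △ c △ c) e ≡ lookup t e
lookup-△-△ t c e = begin
  lookup (t △ c △ c) e                       ≡⟨ lookup-△ (t △ c) c e ⟩
  lookup (t △ c) e xor lookup c e            ≡⟨ cong (_xor lookup c e) (lookup-△ t c e) ⟩
  (lookup t e xor lookup c e) xor lookup c e ≡⟨ BP.xor-assoc (lookup t e) (lookup c e) (lookup c e) ⟩
  lookup t e xor (lookup c e xor lookup c e) ≡⟨ cong (lookup t e xor_) (BP.xor-same (lookup c e)) ⟩
  lookup t e xor false                       ≡⟨ BP.xor-identityʳ (lookup t e) ⟩
  lookup t e                                 ∎
  where open ≡-Reasoning

⊆ᵇ-△ : ∀ {m} (t : Vec Bool m) {c s} → c ⊆ s → t △ c ⊆ᵇ s ≡ t ⊆ᵇ s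
⊆ᵇ-△ t {c} {s} c⊆s = ⊆ᵇ-cong (t △ c) s t s
  (λ t△c⊆s e p → △-⊆ (t △ c) c {s} t△c⊆s c⊆s e (trans (lookup-△-△ t c e) p))
  (λ t⊆s → △-⊆ t c {s} t⊆s c⊆s)

⊆-insert : ∀ {m} (s : Vec Bool m) e → s ⊆ s [ e ]≔ true
⊆-insert s e f p with e F.≟ f
... | yes refl = VP.lookup∘update e s true
... | no e≢f = trans (VP.lookup∘update′ (e≢f ∘ sym) s true) p

⊆ᵇ-insert : ∀ {m} (t s : Vec Bool m) {e} → lookup t e ≡ false → t ⊆ᵇ (s [ e ]≔ true) ≡ t ⊆ᵇ s
⊆ᵇ-insert t s {e} te = ⊆ᵇ-cong t (s [ e ]≔ true) t s to (λ t⊆s f p → ⊆-insert s e f (t⊆s f p))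
  where
  to : t ⊆ s [ e ]≔ true → t ⊆ s
  to t⊆s⁺ f p with e F.≟ f
  ... | yes refl = ⊥-elim (true≢false p te)
  ... | no e≢f = trans (sym (VP.lookup∘update′ (e≢f ∘ sym) s true)) (t⊆s⁺ f p)

⊆ᵇ-∉ : ∀ {m} (t s : Vec Bool m) {e} → lookup t e ≡ true → lookup s e ≡ false → t ⊆ᵇ s ≡ false
⊆ᵇ-∉ t s te se = BP.¬-not λ p → true≢false (⊆ᵇ-true⁻ t s p _ te) se

card-insert : ∀ {m} (s : Vec Bool m) e → lookup s e ≡ false → card (s [ e ]≔ true) ≡ suc (card s)
card-insert (false ∷ s) zero p = refl
card-insert (true ∷ s) (suc e) p = cong suc (card-insert s e p)
card-insert (false ∷ s) (suc e) p = card-insert s e p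

card-replicate : ∀ m b → card (replicate m b) ≡ (if b then m else 0)
card-replicate zero true = refl
card-replicate zero false = refl
card-replicate (suc m) true = cong suc (card-replicate m true)
card-replicate (suc m) false = card-replicate m false

card-complement : ∀ {m} (s : Vec Bool m) → card s ℕ.+ card (Vec.map not s) ≡ m
card-complement [] = refl
card-complement (true ∷ s) = cong suc (card-complement s)
card-complement {suc m} (false ∷ s) = trans (ℕP.+-suc (card s) _) (cong suc (card-complement s))

insertion-induction : ∀ {m} (P : Vec Bool m → Set) → P (replicate m false) →
  (∀ s e → lookup s e ≡ false → P s → P (s [ e ]≔ true)) → ∀ s → P s
insertion-induction P base step [] = base
insertion-induction P base step (false ∷ s) =
  insertion-induction (P ∘ (false ∷_)) base (λ s e → step (false ∷ s) (suc e)) s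
insertion-induction P base step (true ∷ s) =
  insertion-induction (P ∘ (true ∷_)) (step _ zero refl base) (λ s e → step (true ∷ s) (suc e)) s

deletion-induction : ∀ {m} (P : Vec Bool m → Set) → P (replicate m true) →
  (∀ s e → lookup s e ≡ false → P (s [ e ]≔ true) → P s) → ∀ s → P s
deletion-induction P base step [] = base
deletion-induction P base step (true ∷ s) =
  deletion-induction (P ∘ (true ∷_)) base (λ s e → step (true ∷ s) (suc e)) s
deletion-induction P base step (false ∷ s) =
  deletion-induction (P ∘ (false ∷_)) (step _ zero refl base) (λ s e → step (false ∷ s) (suc e)) s

-- Saturation of increasing iterations

-- A round that adds nothing is stationary forever, and every other round adds an element,
-- so after n rounds nothing new is reached.
module Saturation {n : ℕ} (F : (Fin n → Bool) → Fin n → Bool) (R : ℕ → Fin n → Bool)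
  (R-suc : ∀ t j → R (suc t) j ≡ F (R t) j)
  (F-infl : ∀ X j → X j ≡ true → F X j ≡ true)
  (F-mono : ∀ X Y → (∀ j → X j ≡ true → Y j ≡ true) → ∀ j → F X j ≡ true → F Y j ≡ true)
  (seed : Fin n) (R-seed : R 0 seed ≡ true) where

  _⊑_ : (Fin n → Bool) → (Fin n → Bool) → Set
  X ⊑ Y = ∀ j → X j ≡ true → Y j ≡ true

  R-step : ∀ t → R t ⊑ R (suc t)
  R-step t j p = subst (_≡ true) (sym (R-suc t j)) (F-infl (R t) j p)

  R-mono-step : ∀ {t w} → R w ⊑ R t → R (suc w) ⊑ R (suc t)
  R-mono-step {t} {w} le j p =
    subst (_≡ true) (sym (R-suc t j)) (F-mono (R w) (R t) le j (subst (_≡ true) (R-suc w j) p))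

  R₀⊑ : ∀ t → R 0 ⊑ R t
  R₀⊑ zero j p = p
  R₀⊑ (suc t) j p = R-step t j (R₀⊑ t j p)

  stationary⇒saturated : ∀ t → R (suc t) ⊑ R t → ∀ w → R w ⊑ R t
  stationary⇒saturated t st zero = R₀⊑ t
  stationary⇒saturated t st (suc w) j p = st j (R-mono-step (stationary⇒saturated t st w) j p)

  saturated-or-large : ∀ t → (∀ w → R w ⊑ R t) ⊎ suc t ≤ count (R t)
  saturated-or-large zero = inj₂ (ℕP.≤-trans (s≤s z≤n) (count-< seed (λ _ ()) refl R-seed))
  saturated-or-large (suc t) with anyFin n (λ j → R (suc t) j ∧ not (R t j)) in new
  ... | false = inj₁ λ w j p → R-step t j (stationary⇒saturated t st w j p)
    where
    st : R (suc t) ⊑ R t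
    st j p = BP.¬-not λ q → true≢false (anyFin-intro _ j (∧-true p (cong not q))) new
  ... | true with anyFin-elim _ new | saturated-or-large t
  ...   | j , q | inj₁ sat = ⊥-elim (true≢false (sat (suc t) j (proj₁ (∧-true⁻ q)))
                                                (BP.not-injective (proj₂ (∧-true⁻ q))))
  ...   | j , q | inj₂ large = inj₂ (ℕP.≤-trans (s≤s large)
            (count-< j (R-step t) (BP.not-injective (proj₂ (∧-true⁻ q))) (proj₁ (∧-true⁻ q))))

  saturation : ∀ t → R t ⊑ R n
  saturation t with saturated-or-large n
  ... | inj₁ sat = sat t
  ... | inj₂ large = ⊥-elim (ℕP.<-irrefl refl (ℕP.≤-trans large (count-≤ (R n))))

-- Equivalence classes counted by their least elements

least : ∀ {m} (P : Fin m → Bool) {x : Fin m} → P x ≡ true →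
        ∃ λ i → P i ≡ true × (∀ j → j F.< i → P j ≡ false)
least {suc m} P {x} px with P zero in p₀
... | true = zero , p₀ , λ _ ()
least {suc m} P {zero} px | false = ⊥-elim (true≢false px p₀)
least {suc m} P {suc x} px | false with least (P ∘ suc) px
... | i , pi , below = suc i , pi , λ where
  zero _ → p₀
  (suc j) (s≤s j<i) → below j j<i

<ᵇ-true : ∀ {n} {j i : Fin n} → j F.< i → ⌊ j F.<? i ⌋ ≡ true
<ᵇ-true {j = j} {i} j<i = trans (isYes≗does (j F.<? i)) (dec-true (j F.<? i) j<i)

<ᵇ-true⁻ : ∀ {n} {j i : Fin n} → ⌊ j F.<? i ⌋ ≡ true → j F.< i
<ᵇ-true⁻ {j = j} {i} p with j F.<? i
... | yes j<i = j<i

module _ {n : ℕ} where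

  isLeastIn : (Fin n → Fin n → Bool) → Fin n → Bool
  isLeastIn R i = not (anyFin n λ j → ⌊ j F.<? i ⌋ ∧ R i j)

  -- k G s is definitionally classCount (connected G s).
  classCount : (Fin n → Fin n → Bool) → ℕ
  classCount R = count (isLeastIn R)

  merge : (Fin n → Fin n → Bool) → Fin n → Fin n → Fin n → Fin n → Bool
  merge R a b i j = R i j ∨ ((R i a ∨ R i b) ∧ (R j a ∨ R j b))

  isLeastIn-true⁻ : ∀ R {i} → isLeastIn R i ≡ true → ∀ j → j F.< i → R i j ≡ false
  isLeastIn-true⁻ R {i} p j j<i = BP.¬-not λ q →
    true≢false (anyFin-intro (λ j → ⌊ j F.<? i ⌋ ∧ R i j) j (∧-true (<ᵇ-true j<i) q)) (BP.not-injective p)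

  isLeastIn-true : ∀ R {i} → (∀ j → j F.< i → R i j ≡ false) → isLeastIn R i ≡ true
  isLeastIn-true R {i} h = cong not (BP.¬-not λ p →
    let j , q = anyFin-elim (λ j → ⌊ j F.<? i ⌋ ∧ R i j) p
    in true≢false (proj₂ (∧-true⁻ q)) (h j (<ᵇ-true⁻ (proj₁ (∧-true⁻ q)))))

  classCount-cong : ∀ {R R′} → (∀ i j → R i j ≡ R′ i j) → classCount R ≡ classCount R′
  classCount-cong R≗R′ = sumFinℕ-cong λ i →
    cong (bit ∘ not) (anyFin-cong λ j → cong (⌊ j F.<? i ⌋ ∧_) (R≗R′ i j))

  module _ {R : Fin n → Fin n → Bool} (equiv : IsEquivalence (λ i j → R i j ≡ true)) where
    open IsEquivalence equiv renaming (refl to R-refl; sym to R-sym; trans to R-trans)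

    merge-related : ∀ {a b} → R a b ≡ true → ∀ i j → merge R a b i j ≡ R i j
    merge-related {a} {b} ab i j = bool-ext merged⇒R (∨-trueˡ _)
      where
      toA : ∀ {x} → R x a ∨ R x b ≡ true → R x a ≡ true
      toA p with ∨-true⁻ p
      ... | inj₁ q = q
      ... | inj₂ q = R-trans q (R-sym ab)
      merged⇒R : merge R a b i j ≡ true → R i j ≡ true
      merged⇒R p with ∨-true⁻ p
      ... | inj₁ q = q
      ... | inj₂ q = R-trans (toA (proj₁ (∧-true⁻ q))) (R-sym (toA (proj₂ (∧-true⁻ q))))

    least-unique : ∀ {x m i} → R x m ≡ true → (∀ j → j F.< m → R x j ≡ false) →
                   R i x ≡ true → isLeastIn R i ≡ true → i ≡ m
    least-unique {x} {m} {i} xm below ix i-least with FP.<-cmp i m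
    ... | tri< i<m _ _ = ⊥-elim (true≢false (R-sym ix) (below i i<m))
    ... | tri≈ _ i≡m _ = i≡m
    ... | tri> _ _ m<i = ⊥-elim (true≢false (R-trans ix xm) (isLeastIn-true⁻ R i-least m m<i))

    private
      -- Merging the classes with least elements ma < mb makes mb the only element to stop being least.
      merge-drops : ∀ {a b ma mb} → R a ma ≡ true → (∀ j → j F.< ma → R a j ≡ false) →
                    R b mb ≡ true → (∀ j → j F.< mb → R b j ≡ false) → ma F.< mb →
                    classCount R ≡ suc (classCount (merge R a b))
      merge-drops {a} {b} {ma} {mb} a-ma a-below b-mb b-below ma<mb =
        count-drop mb mb-least mb-not-least others
        where
        mb-least : isLeastIn R mb ≡ true
        mb-least = isLeastIn-true R λ j j<mb → BP.¬-not λ r → true≢false (R-trans b-mb r) (b-below j j<mb)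
        mb-not-least : isLeastIn (merge R a b) mb ≡ false
        mb-not-least = cong not (anyFin-intro _ ma (∧-true (<ᵇ-true ma<mb)
          (∨-trueʳ (R mb ma) (∧-true (∨-trueʳ (R mb a) (R-sym b-mb)) (∨-trueˡ (R ma b) (R-sym a-ma))))))
        others : ∀ i → i ≢ mb → isLeastIn (merge R a b) i ≡ isLeastIn R i
        others i i≢mb = bool-ext
          (λ p → isLeastIn-true R λ j j<i → BP.¬-not λ r →
             true≢false (∨-trueˡ _ r) (isLeastIn-true⁻ (merge R a b) p j j<i))
          (λ p → isLeastIn-true (merge R a b) λ j j<i → BP.¬-not λ q → not-merged p j j<i q)
          where
          not-merged : isLeastIn R i ≡ true → ∀ j → j F.< i → merge R a b i j ≡ true → ⊥
          not-merged p j j<i q with ∨-true⁻ q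
          ... | inj₁ r = true≢false r (isLeastIn-true⁻ R p j j<i)
          ... | inj₂ r with ∧-true⁻ r
          ...   | i-near , j-near with ∨-true⁻ i-near
          ...     | inj₂ ib = i≢mb (least-unique b-mb b-below ib p)
          ...     | inj₁ ia with least-unique a-ma a-below ia p | ∨-true⁻ j-near
          ...       | refl | inj₁ ja = true≢false (R-trans ia (R-sym ja)) (isLeastIn-true⁻ R p j j<i)
          ...       | refl | inj₂ jb = true≢false (R-sym jb) (b-below j (FP.<-trans j<i ma<mb))

    classCount-merge : ∀ {a b} → R a b ≡ false → classCount R ≡ suc (classCount (merge R a b))
    classCount-merge {a} {b} ab with least (R a) R-refl | least (R b) R-refl
    ... | ma , a-ma , a-below | mb , b-mb , b-below with FP.<-cmp ma mb
    ... | tri< ma<mb _ _ = merge-drops a-ma a-below b-mb b-below ma<mb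
    ... | tri≈ _ refl _ = ⊥-elim (true≢false (R-trans a-ma (R-sym b-mb)) ab)
    ... | tri> _ _ mb<ma = trans (merge-drops b-mb b-below a-ma a-below mb<ma)
        (cong suc (classCount-cong λ i j →
          cong (R i j ∨_) (cong₂ _∧_ (BP.∨-comm (R i b) (R i a)) (BP.∨-comm (R j b) (R j a)))))

-- Sums over subsets

ind : Bool → ℚ
ind true  = 1ℚ
ind false = 0ℚ

two : ℚ
two = 1ℚ + 1ℚ

private variable I I′ : Set

sumℚ-++ : ∀ (xs ys : List ℚ) → sumℚ (xs ++ ys) ≡ sumℚ xs + sumℚ ys
sumℚ-++ [] ys = sym (QP.+-identityˡ _)
sumℚ-++ (x ∷ xs) ys = trans (cong (x +_) (sumℚ-++ xs ys)) (sym (QP.+-assoc x _ _))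

sumℚ-cong : ∀ {g h : I → ℚ} → (∀ x → g x ≡ h x) → ∀ xs → sumℚ (map g xs) ≡ sumℚ (map h xs)
sumℚ-cong e [] = refl
sumℚ-cong e (x ∷ xs) = cong₂ _+_ (e x) (sumℚ-cong e xs)

sumℚ-zero : ∀ (xs : List I) → sumℚ (map (λ _ → 0ℚ) xs) ≡ 0ℚ
sumℚ-zero [] = refl
sumℚ-zero (x ∷ xs) = trans (QP.+-identityˡ _) (sumℚ-zero xs)

sumℚ-+ : ∀ (g h : I → ℚ) xs → sumℚ (map (λ x → g x + h x) xs) ≡ sumℚ (map g xs) + sumℚ (map h xs)
sumℚ-+ g h [] = refl
sumℚ-+ g h (x ∷ xs) = trans (cong (g x + h x +_) (sumℚ-+ g h xs)) (+-interchange (g x) (h x) _ _)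

sumℚ-*ˡ : ∀ c (g : I → ℚ) xs → sumℚ (map (λ x → c * g x) xs) ≡ c * sumℚ (map g xs)
sumℚ-*ˡ c g [] = sym (QP.*-zeroʳ c)
sumℚ-*ˡ c g (x ∷ xs) = trans (cong (c * g x +_) (sumℚ-*ˡ c g xs)) (sym (QP.*-distribˡ-+ c (g x) _))

sumℚ-comm : ∀ (g : I → I′ → ℚ) xs ys →
  sumℚ (map (λ x → sumℚ (map (g x) ys)) xs) ≡ sumℚ (map (λ y → sumℚ (map (λ x → g x y) xs)) ys)
sumℚ-comm g [] ys = sym (sumℚ-zero ys)
sumℚ-comm g (x ∷ xs) ys = trans (cong (sumℚ (map (g x) ys) +_) (sumℚ-comm g xs ys))
                                (sym (sumℚ-+ (g x) (λ y → sumℚ (map (λ x → g x y) xs)) ys))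

sumℚ-*ʳ : ∀ c (g : I → ℚ) xs → sumℚ (map (λ x → g x * c) xs) ≡ sumℚ (map g xs) * c
sumℚ-*ʳ c g xs = trans (sumℚ-cong (λ x → QP.*-comm (g x) c) xs) (trans (sumℚ-*ˡ c g xs) (QP.*-comm c _))

sumSubsets : (m : ℕ) → (Vec Bool m → ℚ) → ℚ
sumSubsets m g = sumℚ (map g (allSubsets m))

sumSubsets-suc : ∀ m (g : Vec Bool (suc m) → ℚ) →
  sumSubsets (suc m) g ≡ sumSubsets m (g ∘ (true ∷_)) + sumSubsets m (g ∘ (false ∷_))
sumSubsets-suc m g = begin
  sumℚ (map g (map (true ∷_) (allSubsets m) ++ map (false ∷_) (allSubsets m)))
    ≡⟨ cong sumℚ (LP.map-++ g (map (true ∷_) (allSubsets m)) _) ⟩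
  sumℚ (map g (map (true ∷_) (allSubsets m)) ++ map g (map (false ∷_) (allSubsets m)))
    ≡⟨ sumℚ-++ (map g (map (true ∷_) (allSubsets m))) (map g (map (false ∷_) (allSubsets m))) ⟩
  sumℚ (map g (map (true ∷_) (allSubsets m))) + sumℚ (map g (map (false ∷_) (allSubsets m)))
    ≡⟨ cong₂ (λ xs ys → sumℚ xs + sumℚ ys) (LP.map-∘ (allSubsets m)) (LP.map-∘ (allSubsets m)) ⟨
  sumSubsets m (g ∘ (true ∷_)) + sumSubsets m (g ∘ (false ∷_)) ∎
  where open ≡-Reasoning

sumSubsets-cong : ∀ m {g h : Vec Bool m → ℚ} → (∀ t → g t ≡ h t) → sumSubsets m g ≡ sumSubsets m h
sumSubsets-cong m e = sumℚ-cong e (allSubsets m)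

sumSubsets-△ : ∀ {m} (c : Vec Bool m) (g : Vec Bool m → ℚ) →
               sumSubsets m (λ t → g (t △ c)) ≡ sumSubsets m g
sumSubsets-△ [] g = refl
sumSubsets-△ {suc m} (false ∷ c) g = begin
  sumSubsets (suc m) (λ t → g (t △ (false ∷ c)))
    ≡⟨ sumSubsets-suc m _ ⟩
  sumSubsets m (λ t → g (true ∷ t △ c)) + sumSubsets m (λ t → g (false ∷ t △ c))
    ≡⟨ cong₂ _+_ (sumSubsets-△ c (g ∘ (true ∷_))) (sumSubsets-△ c (g ∘ (false ∷_))) ⟩
  sumSubsets m (g ∘ (true ∷_)) + sumSubsets m (g ∘ (false ∷_))
    ≡⟨ sumSubsets-suc m g ⟨
  sumSubsets (suc m) g ∎
  where open ≡-Reasoning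
sumSubsets-△ {suc m} (true ∷ c) g = begin
  sumSubsets (suc m) (λ t → g (t △ (true ∷ c)))
    ≡⟨ sumSubsets-suc m _ ⟩
  sumSubsets m (λ t → g (false ∷ t △ c)) + sumSubsets m (λ t → g (true ∷ t △ c))
    ≡⟨ cong₂ _+_ (sumSubsets-△ c (g ∘ (false ∷_))) (sumSubsets-△ c (g ∘ (true ∷_))) ⟩
  sumSubsets m (g ∘ (false ∷_)) + sumSubsets m (g ∘ (true ∷_))
    ≡⟨ QP.+-comm (sumSubsets m (g ∘ (false ∷_))) (sumSubsets m (g ∘ (true ∷_))) ⟩
  sumSubsets m (g ∘ (true ∷_)) + sumSubsets m (g ∘ (false ∷_))
    ≡⟨ sumSubsets-suc m g ⟨
  sumSubsets (suc m) g ∎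
  where open ≡-Reasoning

sumSubsets-below-empty : ∀ m (h : Vec Bool m → Bool) →
  sumSubsets m (λ t → ind (t ⊆ᵇ replicate m false ∧ h t)) ≡ ind (h (replicate m false))
sumSubsets-below-empty zero h = QP.+-identityʳ (ind (h []))
sumSubsets-below-empty (suc m) h = begin
  sumSubsets (suc m) (λ t → ind (t ⊆ᵇ replicate (suc m) false ∧ h t))
    ≡⟨ sumSubsets-suc m _ ⟩
  sumSubsets m (λ _ → 0ℚ) + sumSubsets m (λ t → ind (t ⊆ᵇ replicate m false ∧ h (false ∷ t)))
    ≡⟨ cong₂ _+_ (sumℚ-zero (allSubsets m)) (sumSubsets-below-empty m (h ∘ (false ∷_))) ⟩
  0ℚ + ind (h (replicate (suc m) false))
    ≡⟨ QP.+-identityˡ _ ⟩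
  ind (h (replicate (suc m) false)) ∎
  where open ≡-Reasoning

ℚ-ring : AlmostCommutativeRing 0ℓ 0ℓ
ℚ-ring = fromCommutativeRing QP.+-*-commutativeRing λ x → dec⇒maybe (0ℚ QP.≟ x)

weight : ℚ → ∀ {m} → Vec Bool m → ℚ
weight β s = β ^ card s * (1ℚ - β) ^ card (Vec.map not s)

supersets-weight : ∀ β {m} (t : Vec Bool m) → sumSubsets m (λ s → ind (t ⊆ᵇ s) * weight β s) ≡ β ^ card t
supersets-weight β [] = refl
supersets-weight β {suc m} (true ∷ t) = begin
  sumSubsets (suc m) (λ s → ind ((true ∷ t) ⊆ᵇ s) * weight β s)
    ≡⟨ sumSubsets-suc m _ ⟩
  sumSubsets m (λ s → ind (t ⊆ᵇ s) * weight β (true ∷ s)) + sumSubsets m (λ s → 0ℚ * weight β (false ∷ s))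
    ≡⟨ cong₂ _+_ (sumSubsets-cong m λ s → rearrange (ind (t ⊆ᵇ s)) β (β ^ card s) _)
                 (sumSubsets-cong m λ s → QP.*-zeroˡ (weight β (false ∷ s))) ⟩
  sumSubsets m (λ s → β * (ind (t ⊆ᵇ s) * weight β s)) + sumSubsets m (λ _ → 0ℚ)
    ≡⟨ cong₂ _+_ (sumℚ-*ˡ β _ (allSubsets m)) (sumℚ-zero (allSubsets m)) ⟩
  β * sumSubsets m (λ s → ind (t ⊆ᵇ s) * weight β s) + 0ℚ
    ≡⟨ QP.+-identityʳ _ ⟩
  β * sumSubsets m (λ s → ind (t ⊆ᵇ s) * weight β s)
    ≡⟨ cong (β *_) (supersets-weight β t) ⟩
  β * β ^ card t ∎
  where
  open ≡-Reasoning
  rearrange : ∀ i b x y → i * (b * x * y) ≡ b * (i * (x * y))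
  rearrange = ℚ-Solver.solve-∀ ℚ-ring
supersets-weight β {suc m} (false ∷ t) = begin
  sumSubsets (suc m) (λ s → ind ((false ∷ t) ⊆ᵇ s) * weight β s)
    ≡⟨ sumSubsets-suc m _ ⟩
  sumSubsets m (λ s → ind (t ⊆ᵇ s) * weight β (true ∷ s))
    + sumSubsets m (λ s → ind (t ⊆ᵇ s) * weight β (false ∷ s))
    ≡⟨ cong₂ _+_ (sumSubsets-cong m λ s → rearrangeᵗ (ind (t ⊆ᵇ s)) β (β ^ card s) _)
                 (sumSubsets-cong m λ s → rearrangeᶠ (ind (t ⊆ᵇ s)) (1ℚ - β) (β ^ card s) _) ⟩
  sumSubsets m (λ s → β * (ind (t ⊆ᵇ s) * weight β s))
    + sumSubsets m (λ s → (1ℚ - β) * (ind (t ⊆ᵇ s) * weight β s))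
    ≡⟨ cong₂ _+_ (sumℚ-*ˡ β _ (allSubsets m)) (sumℚ-*ˡ (1ℚ - β) _ (allSubsets m)) ⟩
  β * S + (1ℚ - β) * S
    ≡⟨ complementary β S ⟩
  S
    ≡⟨ supersets-weight β t ⟩
  β ^ card t ∎
  where
  open ≡-Reasoning
  S : ℚ
  S = sumSubsets m (λ s → ind (t ⊆ᵇ s) * weight β s)
  rearrangeᵗ : ∀ i b x y → i * (b * x * y) ≡ b * (i * (x * y))
  rearrangeᵗ = ℚ-Solver.solve-∀ ℚ-ring
  rearrangeᶠ : ∀ i b x y → i * (x * (b * y)) ≡ b * (i * (x * y))
  rearrangeᶠ = ℚ-Solver.solve-∀ ℚ-ring
  complementary : ∀ b x → b * x + (1ℚ - b) * x ≡ x
  complementary = ℚ-Solver.solve-∀ ℚ-ring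

ind-split : ∀ a b → ind a ≡ ind (a ∧ b) + ind (a ∧ not b)
ind-split true  true  = refl
ind-split true  false = refl
ind-split false b     = refl

-- Walks, connectivity and components

module Connectivity (G : Multigraph) where

  end₁ end₂ : Fin (nE G) → Fin (nV G)
  end₁ e = proj₁ (ends G e)
  end₂ e = proj₂ (ends G e)

  Edge : EdgeSet G → Fin (nV G) → Fin (nV G) → Set
  Edge s x y = ∃ λ e → lookup s e ≡ true × end₁ e ≡ x × end₂ e ≡ y

  Walk : EdgeSet G → Fin (nV G) → Fin (nV G) → Set
  Walk s = EqClosure (Edge s)

  edge-walk : ∀ {s} e → lookup s e ≡ true → Walk s (end₁ e) (end₂ e)
  edge-walk e p = EqClosure.return (e , p , refl , refl)

  module _ (s : EdgeSet G) where

    adjacent-sound : ∀ {x y} → adjacent G s x y ≡ true → SymClosure (Edge s) x y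
    adjacent-sound p with anyFin-elim _ p
    ... | e , q with ∧-true⁻ q
    ...   | se , ends≈ with ∨-true⁻ ends≈
    ...     | inj₁ r = fwd (e , se , eqb-≡ (proj₁ (∧-true⁻ r)) , eqb-≡ (proj₂ (∧-true⁻ r)))
    ...     | inj₂ r = bwd (e , se , eqb-≡ (proj₁ (∧-true⁻ r)) , eqb-≡ (proj₂ (∧-true⁻ r)))

    adjacent-complete : ∀ {x y} → SymClosure (Edge s) x y → adjacent G s x y ≡ true
    adjacent-complete (fwd (e , se , refl , refl)) =
      anyFin-intro _ e (∧-true se (∨-trueˡ _ (∧-true (eqb-refl (end₁ e)) (eqb-refl (end₂ e)))))
    adjacent-complete (bwd (e , se , refl , refl)) =
      anyFin-intro _ e (∧-true se (∨-trueʳ (eqb (end₁ e) (end₂ e) ∧ eqb (end₂ e) (end₁ e))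
                                           (∧-true (eqb-refl (end₁ e)) (eqb-refl (end₂ e)))))

    reach-sound : ∀ t {i j} → reach G s t i j ≡ true → Walk s i j
    reach-sound zero p with eqb-≡ p
    ... | refl = ε
    reach-sound (suc t) {i} {j} p with ∨-true⁻ {reach G s t i j} p
    ... | inj₁ q = reach-sound t q
    ... | inj₂ q with anyFin-elim (λ a → reach G s t i a ∧ adjacent G s a j) q
    ...   | a , r = reach-sound t {i} {a} (proj₁ (∧-true⁻ r))
                    ◅◅ Star.return (adjacent-sound (proj₂ (∧-true⁻ r)))

    reach-extend : ∀ {t i x y} → reach G s t i x ≡ true → SymClosure (Edge s) x y →
                   reach G s (suc t) i y ≡ true
    reach-extend {t} {i} {x} {y} p step =
      ∨-trueʳ (reach G s t i y) (anyFin-intro (λ a → reach G s t i a ∧ adjacent G s a y) x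
                                              (∧-true p (adjacent-complete step)))

    reach-complete : ∀ {i j} → Walk s i j → ∃ λ t → reach G s t i j ≡ true
    reach-complete = Star.foldl (λ i j → ∃ λ t → reach G s t i j ≡ true)
      (λ (t , p) step → suc t , reach-extend {t} p step) (0 , eqb-refl _)

    extend : (Fin (nV G) → Bool) → Fin (nV G) → Bool
    extend X j = X j ∨ anyFin (nV G) λ a → X a ∧ adjacent G s a j

    extend-mono : ∀ X Y → (∀ j → X j ≡ true → Y j ≡ true) →
                  ∀ j → extend X j ≡ true → extend Y j ≡ true
    extend-mono X Y X⊑Y j p with ∨-true⁻ p
    ... | inj₁ q = ∨-trueˡ _ (X⊑Y j q)
    ... | inj₂ q with anyFin-elim _ q
    ...   | a , r = ∨-trueʳ _ (anyFin-intro _ a (∧-true (X⊑Y a (proj₁ (∧-true⁻ r))) (proj₂ (∧-true⁻ r))))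

    walk⇒connected : ∀ {i j} → Walk s i j → connected G s i j ≡ true
    walk⇒connected {i} {j} w = let t , p = reach-complete w in saturation t j p
      where
      open Saturation extend (λ t → reach G s t i) (λ _ _ → refl) (λ X j → ∨-trueˡ _)
                      extend-mono i (eqb-refl i)

    connected⇒walk : ∀ {i j} → connected G s i j ≡ true → Walk s i j
    connected⇒walk = reach-sound (nV G)

  walk-mono : ∀ {s s′} → s ⊆ s′ → ∀ {i j} → Walk s i j → Walk s′ i j
  walk-mono s⊆s′ = EqClosure.map λ (e , se , p) → e , s⊆s′ e se , p

  walk-empty : ∀ {i j} → Walk (replicate (nE G) false) i j → i ≡ j
  walk-empty = EqClosure.fold isEquivalence
    λ (e , se , _) → ⊥-elim (true≢false se (VP.lookup-replicate e false))

  module Insertion (s : EdgeSet G) (e : Fin (nE G)) where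

    s⁺ : EdgeSet G
    s⁺ = s [ e ]≔ true

    Near : Fin (nV G) → Set
    Near x = Walk s x (end₁ e) ⊎ Walk s x (end₂ e)

    near-transport : ∀ {x y} → Walk s x y → Near y → Near x
    near-transport w (inj₁ p) = inj₁ (w ◅◅ p)
    near-transport w (inj₂ p) = inj₂ (w ◅◅ p)

    Merged : Fin (nV G) → Fin (nV G) → Set
    Merged i j = Walk s i j ⊎ (Near i × Near j)

    merged-isEquivalence : IsEquivalence Merged
    merged-isEquivalence = record { refl = inj₁ ε ; sym = merged-sym ; trans = merged-trans }
      where
      merged-sym : ∀ {i j} → Merged i j → Merged j i
      merged-sym (inj₁ w) = inj₁ (EqClosure.symmetric _ w)
      merged-sym (inj₂ (p , q)) = inj₂ (q , p)
      merged-trans : ∀ {i j k} → Merged i j → Merged j k → Merged i k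
      merged-trans (inj₁ w) (inj₁ w′) = inj₁ (w ◅◅ w′)
      merged-trans (inj₁ w) (inj₂ (p , q)) = inj₂ (near-transport w p , q)
      merged-trans (inj₂ (p , q)) (inj₁ w) = inj₂ (p , near-transport (EqClosure.symmetric _ w) q)
      merged-trans (inj₂ (p , _)) (inj₂ (_ , q)) = inj₂ (p , q)

    edge-insert⁻ : ∀ {x y} → Edge s⁺ x y → Merged x y
    edge-insert⁻ (f , s⁺f , p , q) with e F.≟ f
    ... | yes refl with p | q
    ...   | refl | refl = inj₂ (inj₁ ε , inj₂ ε)
    edge-insert⁻ (f , s⁺f , p , q) | no e≢f =
      inj₁ (EqClosure.return (f , trans (sym (VP.lookup∘update′ (e≢f ∘ sym) s true)) s⁺f , p , q))

    walk-insert⁻ : ∀ {i j} → Walk s⁺ i j → Merged i j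
    walk-insert⁻ = EqClosure.fold merged-isEquivalence edge-insert⁻

    near⁺ : ∀ {x} → Near x → Walk s⁺ x (end₁ e)
    near⁺ (inj₁ w) = walk-mono {s} {s⁺} (⊆-insert s e) w
    near⁺ (inj₂ w) = walk-mono {s} {s⁺} (⊆-insert s e) w
                     ◅◅ EqClosure.symmetric _ (edge-walk {s⁺} e (VP.lookup∘update e s true))

    walk-insert⁺ : ∀ {i j} → Merged i j → Walk s⁺ i j
    walk-insert⁺ (inj₁ w) = walk-mono {s} {s⁺} (⊆-insert s e) w
    walk-insert⁺ (inj₂ (p , q)) = near⁺ p ◅◅ EqClosure.symmetric _ (near⁺ q)

module Components (G : Multigraph) where
  open Connectivity G

  connected-isEquivalence : ∀ s → IsEquivalence (λ i j → connected G s i j ≡ true)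
  connected-isEquivalence s = record
    { refl  = walk⇒connected s ε
    ; sym   = λ p → walk⇒connected s (EqClosure.symmetric _ (connected⇒walk s p))
    ; trans = λ p q → walk⇒connected s (connected⇒walk s p ◅◅ connected⇒walk s q)
    }

  components-empty : k G (replicate (nE G) false) ≡ nV G
  components-empty = count-all _ λ i → isLeastIn-true (connected G ∅) {i} λ j j<i → BP.¬-not λ p →
    FP.<-irrefl (sym (walk-empty (connected⇒walk ∅ p))) j<i
    where
    ∅ : EdgeSet G
    ∅ = replicate (nE G) false

  module _ (s : EdgeSet G) (e : Fin (nE G)) where
    open Insertion s e

    connected-insert : ∀ i j → connected G s⁺ i j ≡ merge (connected G s) (end₁ e) (end₂ e) i j
    connected-insert i j = bool-ext
      (λ p → merged⇒merge (walk-insert⁻ (connected⇒walk s⁺ p)))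
      (λ p → walk⇒connected s⁺ (walk-insert⁺ (merge⇒merged p)))
      where
      nearᵇ : ∀ {x} → Near x → connected G s x (end₁ e) ∨ connected G s x (end₂ e) ≡ true
      nearᵇ (inj₁ w) = ∨-trueˡ _ (walk⇒connected s w)
      nearᵇ (inj₂ w) = ∨-trueʳ _ (walk⇒connected s w)
      near : ∀ {x} → connected G s x (end₁ e) ∨ connected G s x (end₂ e) ≡ true → Near x
      near p with ∨-true⁻ p
      ... | inj₁ q = inj₁ (connected⇒walk s q)
      ... | inj₂ q = inj₂ (connected⇒walk s q)
      merged⇒merge : Merged i j → merge (connected G s) (end₁ e) (end₂ e) i j ≡ true
      merged⇒merge (inj₁ w) = ∨-trueˡ _ (walk⇒connected s w)
      merged⇒merge (inj₂ (p , q)) = ∨-trueʳ (connected G s i j) (∧-true (nearᵇ p) (nearᵇ q))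
      merge⇒merged : merge (connected G s) (end₁ e) (end₂ e) i j ≡ true → Merged i j
      merge⇒merged p with ∨-true⁻ p
      ... | inj₁ q = inj₁ (connected⇒walk s q)
      ... | inj₂ q = inj₂ (near (proj₁ (∧-true⁻ q)) , near (proj₂ (∧-true⁻ q)))

    components-insert-cycle : connected G s (end₁ e) (end₂ e) ≡ true → k G s⁺ ≡ k G s
    components-insert-cycle ab = classCount-cong λ i j →
      trans (connected-insert i j) (merge-related (connected-isEquivalence s) ab i j)

    components-insert-bridge : connected G s (end₁ e) (end₂ e) ≡ false → k G s ≡ suc (k G s⁺)
    components-insert-bridge ab = trans (classCount-merge (connected-isEquivalence s) ab)
      (cong suc (sym (classCount-cong connected-insert)))

-- Even subgraphs

module EvenSubgraphs (G : Multigraph) where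
  open Connectivity G

  -- A loop has both ends at the same vertex and contributes nothing.
  endParity : Fin (nE G) → Fin (nV G) → Bool
  endParity e i = eqb (end₁ e) i xor eqb (end₂ e) i

  degreeParity : EdgeSet G → Fin (nV G) → Bool
  degreeParity s i = ⊕.sum λ e → lookup s e ∧ endParity e i

  odd-degree : ∀ s i → odd (degree G s i) ≡ degreeParity s i
  odd-degree s i = trans (odd-sumFinℕ {nE G} ends-at-i)
                         (⊕.sum-cong-≗ λ e → odd-if (lookup s e) (eqb (end₁ e) i) (eqb (end₂ e) i))
    where
    ends-at-i : Fin (nE G) → ℕ
    ends-at-i e = if lookup s e then bit (eqb (end₁ e) i) ℕ.+ bit (eqb (end₂ e) i) else 0
    odd-if : ∀ b x y → odd (if b then bit x ℕ.+ bit y else 0) ≡ b ∧ (x xor y)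
    odd-if false x     y     = refl
    odd-if true  false false = refl
    odd-if true  false true  = refl
    odd-if true  true  false = refl
    odd-if true  true  true  = refl

  isEven : EdgeSet G → Bool
  isEven s = not (anyFin (nV G) λ i → odd (degree G s i))

  isEven-true⁻ : ∀ {s} → isEven s ≡ true → ∀ i → degreeParity s i ≡ false
  isEven-true⁻ {s} p i = BP.¬-not λ q → true≢false
    (anyFin-intro (λ i → odd (degree G s i)) i (trans (odd-degree s i) q)) (BP.not-injective p)

  degreeParity-△ : ∀ t c i → degreeParity (t △ c) i ≡ degreeParity t i xor degreeParity c i
  degreeParity-△ t c i = trans
    (⊕.sum-cong-≗ λ e → trans (cong (_∧ endParity e i) (lookup-△ t c e))
                              (BP.∧-distribʳ-xor (endParity e i) (lookup t e) (lookup c e)))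
    (⊕.∑-distrib-+ (λ e → lookup t e ∧ endParity e i) (λ e → lookup c e ∧ endParity e i))

  isEven-△ : ∀ t {c} → (∀ i → degreeParity c i ≡ false) → isEven (t △ c) ≡ isEven t
  isEven-△ t {c} c-even = cong not (anyFin-cong λ i → begin
    odd (degree G (t △ c) i)                ≡⟨ odd-degree (t △ c) i ⟩
    degreeParity (t △ c) i                  ≡⟨ degreeParity-△ t c i ⟩
    degreeParity t i xor degreeParity c i   ≡⟨ cong (degreeParity t i xor_) (c-even i) ⟩
    degreeParity t i xor false              ≡⟨ BP.xor-identityʳ _ ⟩
    degreeParity t i                        ≡⟨ odd-degree t i ⟨
    odd (degree G t i)                      ∎)
    where open ≡-Reasoning

  degreeParity-singleton : ∀ e i → degreeParity (singleton e) i ≡ endParity e i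
  degreeParity-singleton e i = trans
    (⊕.sum-cong-≗ λ f → cong (_∧ endParity f i) (VP.lookup∘tabulate (eqb e) f))
    (⊕-select e (λ f → endParity f i))

  record PathParity (s : EdgeSet G) (x y : Fin (nV G)) : Set where
    constructor pathParity
    field
      path     : EdgeSet G
      path⊆s   : path ⊆ s
      parity   : ∀ i → degreeParity path i ≡ eqb x i xor eqb y i

  pathParity-isEquivalence : ∀ s → IsEquivalence (PathParity s)
  pathParity-isEquivalence s = record { refl = pp-refl ; sym = pp-sym ; trans = pp-trans }
    where
    pp-refl : ∀ {x} → PathParity s x x
    pp-refl {x} = pathParity (replicate (nE G) false)
      (λ e p → ⊥-elim (true≢false p (VP.lookup-replicate e false)))
      λ i → trans (⊕-sum-false _ λ e → cong (_∧ endParity e i) (VP.lookup-replicate e false))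
                    (sym (BP.xor-same (eqb x i)))
    pp-sym : ∀ {x y} → PathParity s x y → PathParity s y x
    pp-sym {x} {y} (pathParity P P⊆s parity) =
      pathParity P P⊆s λ i → trans (parity i) (BP.xor-comm (eqb x i) (eqb y i))
    pp-trans : ∀ {x y z} → PathParity s x y → PathParity s y z → PathParity s x z
    pp-trans {x} {y} {z} (pathParity P P⊆s P-parity) (pathParity Q Q⊆s Q-parity) =
      pathParity (P △ Q) (△-⊆ P Q {s} P⊆s Q⊆s) λ i →
        trans (degreeParity-△ P Q i)
              (trans (cong₂ _xor_ (P-parity i) (Q-parity i)) (xor-cancel-middle (eqb x i) (eqb y i) (eqb z i)))

  edge-parity : ∀ {s x y} → Edge s x y → PathParity s x y
  edge-parity {s} (e , se , refl , refl) =
    pathParity (singleton e) (singleton-⊆ {s = s} se) (degreeParity-singleton e)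

  walk-parity : ∀ {s x y} → Walk s x y → PathParity s x y
  walk-parity {s} = EqClosure.fold (pathParity-isEquivalence s) edge-parity

  endParity-weighted : ∀ (C : Fin (nV G) → Bool) f →
                       ⊕.sum (λ i → C i ∧ endParity f i) ≡ C (end₁ f) xor C (end₂ f)
  endParity-weighted C f = begin
    ⊕.sum (λ i → C i ∧ endParity f i)
      ≡⟨ ⊕.sum-cong-≗ (λ i → trans (BP.∧-distribˡ-xor (C i) (eqb (end₁ f) i) (eqb (end₂ f) i))
                         (cong₂ _xor_ (BP.∧-comm (C i) (eqb (end₁ f) i)) (BP.∧-comm (C i) (eqb (end₂ f) i)))) ⟩
    ⊕.sum (λ i → (eqb (end₁ f) i ∧ C i) xor (eqb (end₂ f) i ∧ C i))
      ≡⟨ ⊕.∑-distrib-+ (λ i → eqb (end₁ f) i ∧ C i) (λ i → eqb (end₂ f) i ∧ C i) ⟩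
    ⊕.sum (λ i → eqb (end₁ f) i ∧ C i) xor ⊕.sum (λ i → eqb (end₂ f) i ∧ C i)
      ≡⟨ cong₂ _xor_ (⊕-select (end₁ f) C) (⊕-select (end₂ f) C) ⟩
    C (end₁ f) xor C (end₂ f) ∎
    where open ≡-Reasoning

  cut-parity : ∀ t (C : Fin (nV G) → Bool) →
    ⊕.sum (λ i → C i ∧ degreeParity t i) ≡ ⊕.sum (λ f → lookup t f ∧ (C (end₁ f) xor C (end₂ f)))
  cut-parity t C = begin
    ⊕.sum (λ i → C i ∧ degreeParity t i)
      ≡⟨ ⊕.sum-cong-≗ (λ i → ⊕.*-distribˡ-sum (C i) (λ f → lookup t f ∧ endParity f i)) ⟩
    ⊕.sum (λ i → ⊕.sum λ f → C i ∧ (lookup t f ∧ endParity f i))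
      ≡⟨ ⊕.∑-comm (λ i f → C i ∧ (lookup t f ∧ endParity f i)) ⟩
    ⊕.sum (λ f → ⊕.sum λ i → C i ∧ (lookup t f ∧ endParity f i))
      ≡⟨ ⊕.sum-cong-≗ (λ f → ⊕.sum-cong-≗ λ i → ∧-left-comm (C i) (lookup t f) (endParity f i)) ⟩
    ⊕.sum (λ f → ⊕.sum λ i → lookup t f ∧ (C i ∧ endParity f i))
      ≡⟨ ⊕.sum-cong-≗ (λ f → sym (⊕.*-distribˡ-sum (lookup t f) (λ i → C i ∧ endParity f i))) ⟩
    ⊕.sum (λ f → lookup t f ∧ ⊕.sum (λ i → C i ∧ endParity f i))
      ≡⟨ ⊕.sum-cong-≗ (λ f → cong (lookup t f ∧_) (endParity-weighted C f)) ⟩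
    ⊕.sum (λ f → lookup t f ∧ (C (end₁ f) xor C (end₂ f))) ∎
    where
    open ≡-Reasoning
    ∧-left-comm : ∀ a b c → a ∧ (b ∧ c) ≡ b ∧ (a ∧ c)
    ∧-left-comm a b c = trans (sym (BP.∧-assoc a b c)) (trans (cong (_∧ c) (BP.∧-comm a b)) (BP.∧-assoc b a c))

  even-cut : ∀ {t} → isEven t ≡ true → ∀ C →
             ⊕.sum (λ f → lookup t f ∧ (C (end₁ f) xor C (end₂ f))) ≡ false
  even-cut {t} t-even C = trans (sym (cut-parity t C))
    (⊕-sum-false _ λ i → trans (cong (C i ∧_) (isEven-true⁻ {t} t-even i)) (BP.∧-zeroʳ (C i)))

module EvenSubgraphCount (G : Multigraph) where
  open Connectivity G
  open Components G
  open EvenSubgraphs G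

  evenCount : EdgeSet G → ℚ
  evenCount s = sumSubsets (nE G) λ t → ind (t ⊆ᵇ s ∧ isEven t)

  module _ (s : EdgeSet G) (e : Fin (nE G)) (e∉s : lookup s e ≡ false) where
    open Insertion s e
    open IsEquivalence (connected-isEquivalence s) using () renaming (trans to connected-trans)

    through avoids : EdgeSet G → Bool
    through t = (t ⊆ᵇ s⁺ ∧ isEven t) ∧ lookup t e
    avoids  t = (t ⊆ᵇ s⁺ ∧ isEven t) ∧ not (lookup t e)

    avoids-even : ∀ t → avoids t ≡ t ⊆ᵇ s ∧ isEven t
    avoids-even t with lookup t e in te
    ... | false = trans (BP.∧-identityʳ _) (cong (_∧ isEven t) (⊆ᵇ-insert t s te))
    ... | true = trans (BP.∧-zeroʳ _) (sym (cong (_∧ isEven t) (⊆ᵇ-∉ t s te e∉s)))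

    evenCount-insert : evenCount s⁺ ≡ sumSubsets (nE G) (ind ∘ through) + evenCount s
    evenCount-insert = begin
      evenCount s⁺
        ≡⟨ sumSubsets-cong (nE G) (λ t → ind-split (t ⊆ᵇ s⁺ ∧ isEven t) (lookup t e)) ⟩
      sumSubsets (nE G) (λ t → ind (through t) + ind (avoids t))
        ≡⟨ sumℚ-+ (ind ∘ through) (ind ∘ avoids) (allSubsets (nE G)) ⟩
      sumSubsets (nE G) (ind ∘ through) + sumSubsets (nE G) (ind ∘ avoids)
        ≡⟨ cong (sumSubsets (nE G) (ind ∘ through) +_) (sumSubsets-cong (nE G) (cong ind ∘ avoids-even)) ⟩
      sumSubsets (nE G) (ind ∘ through) + evenCount s ∎
      where open ≡-Reasoning

    -- e is the only edge of s⁺ crossing the cut around the component of end₁ e in s, while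
    -- an even subgraph crosses every cut an even number of times.
    through-bridge : connected G s (end₁ e) (end₂ e) ≡ false → ∀ t → through t ≡ false
    through-bridge ab t with t ⊆ᵇ s⁺ in t⊆s⁺ | isEven t in t-even | lookup t e in te
    ... | false | _     | _     = refl
    ... | true  | false | _     = refl
    ... | true  | true  | false = refl
    ... | true  | true  | true  = ⊥-elim (true≢false crossing (even-cut {t} t-even C))
      where
      C : Fin (nV G) → Bool
      C = connected G s (end₁ e)
      C-edge : ∀ f → lookup s f ≡ true → C (end₁ f) ≡ C (end₂ f)
      C-edge f sf = bool-ext (λ p → connected-trans p (walk⇒connected s (edge-walk {s} f sf)))
        (λ p → connected-trans p (walk⇒connected s (EqClosure.symmetric _ (edge-walk {s} f sf))))
      others : ∀ f → f ≢ e → lookup t f ∧ (C (end₁ f) xor C (end₂ f)) ≡ false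
      others f f≢e with lookup t f in tf
      ... | false = refl
      ... | true = trans (cong (_xor C (end₂ f)) (C-edge f sf)) (BP.xor-same (C (end₂ f)))
        where
        sf : lookup s f ≡ true
        sf = trans (sym (VP.lookup∘update′ f≢e s true)) (⊆ᵇ-true⁻ t s⁺ t⊆s⁺ f tf)
      crossing : ⊕.sum (λ f → lookup t f ∧ (C (end₁ f) xor C (end₂ f))) ≡ true
      crossing = trans (⊕-single e _ others) (cong₂ _∧_ te (cong₂ _xor_ (walk⇒connected s ε) ab))

    through-cycle : connected G s (end₁ e) (end₂ e) ≡ true → sumSubsets (nE G) (ind ∘ through) ≡ evenCount s
    through-cycle ab = begin
      sumSubsets (nE G) (ind ∘ through)
        ≡⟨ sumSubsets-△ cycle (ind ∘ through) ⟨
      sumSubsets (nE G) (λ t → ind (through (t △ cycle)))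
        ≡⟨ sumSubsets-cong (nE G) (cong ind ∘ through-△) ⟩
      sumSubsets (nE G) (ind ∘ avoids)
        ≡⟨ sumSubsets-cong (nE G) (cong ind ∘ avoids-even) ⟩
      evenCount s ∎
      where
      open ≡-Reasoning
      open PathParity (walk-parity {s} (connected⇒walk s ab))
      cycle : EdgeSet G
      cycle = path △ singleton e
      cycle⊆s⁺ : cycle ⊆ s⁺
      cycle⊆s⁺ = △-⊆ path (singleton e) {s⁺} (λ f p → ⊆-insert s e f (path⊆s f p))
                                           (singleton-⊆ {s = s⁺} (VP.lookup∘update e s true))
      cycle-even : ∀ i → degreeParity cycle i ≡ false
      cycle-even i = trans (degreeParity-△ path (singleton e) i)
        (trans (cong₂ _xor_ (parity i) (degreeParity-singleton e i)) (BP.xor-same (endParity e i)))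
      e∈cycle : lookup cycle e ≡ true
      e∈cycle = trans (lookup-△ path (singleton e) e)
        (cong₂ _xor_ (BP.¬-not λ p → true≢false (path⊆s e p) e∉s)
                     (trans (VP.lookup∘tabulate (eqb e) e) (eqb-refl e)))
      through-△ : ∀ t → through (t △ cycle) ≡ avoids t
      through-△ t = cong₂ _∧_ (cong₂ _∧_ (⊆ᵇ-△ t cycle⊆s⁺) (isEven-△ t cycle-even))
        (trans (lookup-△ t cycle e) (trans (cong (lookup t e xor_) e∈cycle) (BP.xor-comm (lookup t e) true)))

    evenCount-insert-cycle : connected G s (end₁ e) (end₂ e) ≡ true → evenCount s⁺ ≡ evenCount s + evenCount s
    evenCount-insert-cycle ab = trans evenCount-insert (cong (_+ evenCount s) (through-cycle ab))

    evenCount-insert-bridge : connected G s (end₁ e) (end₂ e) ≡ false → evenCount s⁺ ≡ evenCount s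
    evenCount-insert-bridge ab = trans evenCount-insert
      (trans (cong (_+ evenCount s) (trans (sumSubsets-cong (nE G) (cong ind ∘ through-bridge ab))
                                           (sumℚ-zero (allSubsets (nE G)))))
             (QP.+-identityˡ (evenCount s)))

-- Nullity

module Nullity (G : Multigraph) where
  open Connectivity G
  open Components G
  open EvenSubgraphs G
  open EvenSubgraphCount G

  size : EdgeSet G → ℕ
  size s = card s ℕ.+ k G s

  data InsertionEffect (s : EdgeSet G) (e : Fin (nE G)) : Set where
    closes-cycle : k G (s [ e ]≔ true) ≡ k G s → size (s [ e ]≔ true) ≡ suc (size s) →
                   evenCount (s [ e ]≔ true) ≡ evenCount s + evenCount s → InsertionEffect s e
    joins-components : k G s ≡ suc (k G (s [ e ]≔ true)) → size (s [ e ]≔ true) ≡ size s →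
                       evenCount (s [ e ]≔ true) ≡ evenCount s → InsertionEffect s e

  insertionEffect : ∀ s e → lookup s e ≡ false → InsertionEffect s e
  insertionEffect s e e∉s with connected G s (end₁ e) (end₂ e) in ab
  ... | true = closes-cycle same-k (cong₂ ℕ._+_ (card-insert s e e∉s) same-k) (evenCount-insert-cycle s e e∉s ab)
    where
    same-k : k G (s [ e ]≔ true) ≡ k G s
    same-k = components-insert-cycle s e ab
  ... | false = joins-components fewer-k size-same (evenCount-insert-bridge s e e∉s ab)
    where
    fewer-k : k G s ≡ suc (k G (s [ e ]≔ true))
    fewer-k = components-insert-bridge s e ab
    size-same : size (s [ e ]≔ true) ≡ size s
    size-same = begin
      card (s [ e ]≔ true) ℕ.+ k G (s [ e ]≔ true) ≡⟨ cong (ℕ._+ k G (s [ e ]≔ true)) (card-insert s e e∉s) ⟩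
      suc (card s) ℕ.+ k G (s [ e ]≔ true)         ≡⟨ ℕP.+-suc (card s) _ ⟨
      card s ℕ.+ suc (k G (s [ e ]≔ true))         ≡⟨ cong (card s ℕ.+_) fewer-k ⟨
      card s ℕ.+ k G s                             ∎
      where open ≡-Reasoning

  -- nullity is n(s), stated additively to avoid the truncated subtraction in nul.
  record EvenCountByNullity (s : EdgeSet G) : Set where
    field
      nullity      : ℕ
      rank-nullity : nV G ℕ.+ nullity ≡ size s
      evenCount≡   : evenCount s ≡ two ^ nullity

  evenCountByNullity : ∀ s → EvenCountByNullity s
  evenCountByNullity = insertion-induction EvenCountByNullity base step
    where
    ∅ : EdgeSet G
    ∅ = replicate (nE G) false
    isEven-∅ : isEven ∅ ≡ true
    isEven-∅ = cong not (anyFin-false _ λ i → trans (odd-degree ∅ i)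
      (⊕-sum-false _ λ e → cong (_∧ endParity e i) (VP.lookup-replicate e false)))
    base : EvenCountByNullity ∅
    base = record
      { nullity = 0
      ; rank-nullity = trans (ℕP.+-identityʳ (nV G))
                             (sym (cong₂ ℕ._+_ (card-replicate (nE G) false) components-empty))
      ; evenCount≡ = trans (sumSubsets-below-empty (nE G) isEven) (cong ind isEven-∅)
      }
    double : ∀ x → x + x ≡ two * x
    double = ℚ-Solver.solve-∀ ℚ-ring
    step : ∀ s e → lookup s e ≡ false → EvenCountByNullity s → EvenCountByNullity (s [ e ]≔ true)
    step s e e∉s ev with insertionEffect s e e∉s
    ... | closes-cycle _ size⁺ evenCount⁺ = record
      { nullity = suc nullity
      ; rank-nullity = trans (ℕP.+-suc (nV G) nullity) (trans (cong suc rank-nullity) (sym size⁺))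
      ; evenCount≡ = trans evenCount⁺ (trans (cong (λ x → x + x) evenCount≡) (double (two ^ nullity)))
      }
      where open EvenCountByNullity ev
    ... | joins-components _ size⁺ evenCount⁺ = record
      { nullity = nullity
      ; rank-nullity = trans rank-nullity (sym size⁺)
      ; evenCount≡ = trans evenCount⁺ evenCount≡
      }
      where open EvenCountByNullity ev

  -- rankGap = r(G) - r(s) and nullityGap = n(G) - n(s).
  record GapsToFull (s : EdgeSet G) : Set where
    field
      rankGap     : ℕ
      nullityGap  : ℕ
      rankGap≡    : k G (allE G) ℕ.+ rankGap ≡ k G s
      nullityGap≡ : size s ℕ.+ nullityGap ≡ size (allE G)

  gapsToFull : ∀ s → GapsToFull s
  gapsToFull = deletion-induction GapsToFull base step
    where
    base : GapsToFull (allE G)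
    base = record
      { rankGap = 0 ; nullityGap = 0
      ; rankGap≡ = ℕP.+-identityʳ _ ; nullityGap≡ = ℕP.+-identityʳ _ }
    step : ∀ s e → lookup s e ≡ false → GapsToFull (s [ e ]≔ true) → GapsToFull s
    step s e e∉s gaps with insertionEffect s e e∉s
    ... | closes-cycle k⁺ size⁺ _ = record
      { rankGap = rankGap ; nullityGap = suc nullityGap
      ; rankGap≡ = trans rankGap≡ k⁺
      ; nullityGap≡ = trans (ℕP.+-suc (size s) nullityGap)
                            (trans (cong (ℕ._+ nullityGap) (sym size⁺)) nullityGap≡)
      }
      where open GapsToFull gaps
    ... | joins-components k⁺ size⁺ _ = record
      { rankGap = suc rankGap ; nullityGap = nullityGap
      ; rankGap≡ = trans (ℕP.+-suc _ rankGap) (trans (cong suc rankGap≡) (sym k⁺))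
      ; nullityGap≡ = trans (cong (ℕ._+ nullityGap) (sym size⁺)) nullityGap≡
      }
      where open GapsToFull gaps

-- V = |V|, K = k(E), κ = k(s), c = |s|, cᶜ = |E∖s|, M = |E|, r = r(s), n = n(s),
-- A = r(G) - r(s), N = n(G) - n(s).
exponents : ∀ {V K κ c cᶜ M r n A N : ℕ} →
  κ ℕ.+ r ≡ V → V ℕ.+ n ≡ c ℕ.+ κ → K ℕ.+ A ≡ κ → c ℕ.+ κ ℕ.+ N ≡ M ℕ.+ K → c ℕ.+ cᶜ ≡ M →
  c ≡ r ℕ.+ n × cᶜ ≡ A ℕ.+ N × (c ℕ.+ κ) ∸ V ≡ n × (M ℕ.+ K) ∸ V ≡ n ℕ.+ N × V ∸ K ≡ A ℕ.+ r
exponents {K = K} {c = c} {cᶜ} {r = r} {n} {A} {N} refl V+n refl size refl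
  with ℕP.+-cancelʳ-≡ (K ℕ.+ A) c (r ℕ.+ n) (trans (sym V+n) (reorder₁ K A r n))
  where
  reorder₁ : ∀ K A r n → K ℕ.+ A ℕ.+ r ℕ.+ n ≡ r ℕ.+ n ℕ.+ (K ℕ.+ A)
  reorder₁ = solve-∀
... | refl with ℕP.+-cancelˡ-≡ (r ℕ.+ n ℕ.+ K) cᶜ (A ℕ.+ N)
                  (sym (trans (reorder₂ K A r n N) (trans size (reorder₃ K r n cᶜ))))
  where
  reorder₂ : ∀ K A r n N → r ℕ.+ n ℕ.+ K ℕ.+ (A ℕ.+ N) ≡ r ℕ.+ n ℕ.+ (K ℕ.+ A) ℕ.+ N
  reorder₂ = solve-∀
  reorder₃ : ∀ K r n cᶜ → r ℕ.+ n ℕ.+ cᶜ ℕ.+ K ≡ r ℕ.+ n ℕ.+ K ℕ.+ cᶜ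
  reorder₃ = solve-∀
... | refl = refl , refl
  , trans (cong (_∸ (K ℕ.+ A ℕ.+ r)) (reorder₄ K A r n)) (ℕP.m+n∸m≡n (K ℕ.+ A ℕ.+ r) n)
  , trans (cong (_∸ (K ℕ.+ A ℕ.+ r)) (reorder₅ K A r n N)) (ℕP.m+n∸m≡n (K ℕ.+ A ℕ.+ r) (n ℕ.+ N))
  , trans (cong (_∸ K) (ℕP.+-assoc K A r)) (ℕP.m+n∸m≡n K (A ℕ.+ r))
  where
  reorder₄ : ∀ K A r n → r ℕ.+ n ℕ.+ (K ℕ.+ A) ≡ K ℕ.+ A ℕ.+ r ℕ.+ n
  reorder₄ = solve-∀
  reorder₅ : ∀ K A r n N → r ℕ.+ n ℕ.+ (A ℕ.+ N) ℕ.+ K ≡ K ℕ.+ A ℕ.+ r ℕ.+ (n ℕ.+ N)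
  reorder₅ = solve-∀

^-+ : ∀ x m n → x ^ (m ℕ.+ n) ≡ x ^ m * x ^ n
^-+ x zero n = sym (QP.*-identityˡ (x ^ n))
^-+ x (suc m) n = trans (cong (x *_) (^-+ x m n)) (sym (QP.*-assoc x (x ^ m) (x ^ n)))

^-* : ∀ x y n → (x * y) ^ n ≡ x ^ n * y ^ n
^-* x y zero = refl
^-* x y (suc n) = trans (cong ((x * y) *_) (^-* x y n)) (interchange x y (x ^ n) (y ^ n))
  where
  interchange : ∀ a b c d → a * b * (c * d) ≡ a * c * (b * d)
  interchange = ℚ-Solver.solve-∀ ℚ-ring

weight-identity : ∀ b X Y → b * (X - 1ℚ) ≡ 1ℚ - b → (1ℚ - b) * (Y - 1ℚ) ≡ two * b → ∀ r n A N →
  two ^ n * (b ^ (r ℕ.+ n) * (1ℚ - b) ^ (A ℕ.+ N))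
    ≡ (1ℚ - b) ^ (n ℕ.+ N) * b ^ (A ℕ.+ r) * ((X - 1ℚ) ^ A * (Y - 1ℚ) ^ n)
weight-identity b X Y bX cY r n A N = sym (begin
  (1ℚ - b) ^ (n ℕ.+ N) * b ^ (A ℕ.+ r) * ((X - 1ℚ) ^ A * (Y - 1ℚ) ^ n)
    ≡⟨ cong₂ (λ u v → u * v * ((X - 1ℚ) ^ A * (Y - 1ℚ) ^ n)) (^-+ (1ℚ - b) n N) (^-+ b A r) ⟩
  (1ℚ - b) ^ n * (1ℚ - b) ^ N * (b ^ A * b ^ r) * ((X - 1ℚ) ^ A * (Y - 1ℚ) ^ n)
    ≡⟨ regroup ((1ℚ - b) ^ n) ((1ℚ - b) ^ N) (b ^ A) (b ^ r) ((X - 1ℚ) ^ A) ((Y - 1ℚ) ^ n) ⟩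
  (1ℚ - b) ^ n * (Y - 1ℚ) ^ n * (b ^ A * (X - 1ℚ) ^ A) * (b ^ r * (1ℚ - b) ^ N)
    ≡⟨ cong₂ (λ u v → u * v * (b ^ r * (1ℚ - b) ^ N)) (^-* (1ℚ - b) (Y - 1ℚ) n) (^-* b (X - 1ℚ) A) ⟨
  ((1ℚ - b) * (Y - 1ℚ)) ^ n * (b * (X - 1ℚ)) ^ A * (b ^ r * (1ℚ - b) ^ N)
    ≡⟨ cong₂ (λ u v → u ^ n * v ^ A * (b ^ r * (1ℚ - b) ^ N)) cY bX ⟩
  (two * b) ^ n * (1ℚ - b) ^ A * (b ^ r * (1ℚ - b) ^ N)
    ≡⟨ cong (λ u → u * (1ℚ - b) ^ A * (b ^ r * (1ℚ - b) ^ N)) (^-* two b n) ⟩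
  two ^ n * b ^ n * (1ℚ - b) ^ A * (b ^ r * (1ℚ - b) ^ N)
    ≡⟨ regroup′ (two ^ n) (b ^ n) ((1ℚ - b) ^ A) (b ^ r) ((1ℚ - b) ^ N) ⟩
  two ^ n * (b ^ r * b ^ n * ((1ℚ - b) ^ A * (1ℚ - b) ^ N))
    ≡⟨ cong₂ (λ u v → two ^ n * (u * v)) (^-+ b r n) (^-+ (1ℚ - b) A N) ⟨
  two ^ n * (b ^ (r ℕ.+ n) * (1ℚ - b) ^ (A ℕ.+ N)) ∎)
  where
  open ≡-Reasoning
  regroup : ∀ p q s t u v → p * q * (s * t) * (u * v) ≡ p * v * (s * u) * (t * q)
  regroup = ℚ-Solver.solve-∀ ℚ-ring
  regroup′ : ∀ p q s t u → p * q * s * (t * u) ≡ p * (t * q * (s * u))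
  regroup′ = ℚ-Solver.solve-∀ ℚ-ring

f-at-zero : ∀ d → f d 0ℚ ≡ ind (not (odd d))
f-at-zero zero = refl
f-at-zero (suc zero) = refl
f-at-zero (suc (suc d)) = begin
  0ℚ * f (suc d) 0ℚ + f d 0ℚ   ≡⟨ cong (_+ f d 0ℚ) (QP.*-zeroˡ (f (suc d) 0ℚ)) ⟩
  0ℚ + f d 0ℚ                  ≡⟨ QP.+-identityˡ (f d 0ℚ) ⟩
  f d 0ℚ                       ≡⟨ f-at-zero d ⟩
  ind (not (odd d))            ≡⟨ cong (ind ∘ not) (BP.not-involutive (odd d)) ⟨
  ind (not (not (not (odd d)))) ∎
  where open ≡-Reasoning

prodFinℚ-ind : ∀ n (g : Fin n → Bool) → prodFinℚ n (λ i → ind (not (g i))) ≡ ind (not (anyFin n g))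
prodFinℚ-ind zero g = refl
prodFinℚ-ind (suc n) g with g zero
... | true = QP.*-zeroˡ (prodFinℚ n (λ i → ind (not (g (suc i)))))
... | false = trans (QP.*-identityˡ _) (prodFinℚ-ind n (g ∘ suc))

ind-∧ : ∀ a b → ind (a ∧ b) ≡ ind a * ind b
ind-∧ true true = refl
ind-∧ true false = refl
ind-∧ false true = refl
ind-∧ false false = refl

module Expansion (G : Multigraph) where
  open EvenSubgraphs G
  open EvenSubgraphCount G
  open Nullity G

  θ-at-zero : ∀ β → θ G β 0ℚ ≡ sumSubsets (nE G) (λ t → β ^ card t * ind (isEven t))
  θ-at-zero β = sumSubsets-cong (nE G) λ t → cong (β ^ card t *_)
    (trans (prodFinℚ-cong λ i → f-at-zero (degree G t i)) (prodFinℚ-ind (nV G) (λ i → odd (degree G t i))))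
    where
    prodFinℚ-cong : ∀ {n} {g h : Fin n → ℚ} → (∀ i → g i ≡ h i) → prodFinℚ n g ≡ prodFinℚ n h
    prodFinℚ-cong {zero} e = refl
    prodFinℚ-cong {suc n} e = cong₂ _*_ (e zero) (prodFinℚ-cong (e ∘ suc))

  even-expansion : ∀ β → sumSubsets (nE G) (λ t → β ^ card t * ind (isEven t))
                       ≡ sumSubsets (nE G) (λ s → evenCount s * weight β s)
  even-expansion β = begin
    sumSubsets M (λ t → β ^ card t * ind (isEven t))
      ≡⟨ sumSubsets-cong M expand ⟩
    sumSubsets M (λ t → sumSubsets M λ s → ind (t ⊆ᵇ s ∧ isEven t) * weight β s)
      ≡⟨ sumℚ-comm (λ t s → ind (t ⊆ᵇ s ∧ isEven t) * weight β s) (allSubsets M) (allSubsets M) ⟩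
    sumSubsets M (λ s → sumSubsets M λ t → ind (t ⊆ᵇ s ∧ isEven t) * weight β s)
      ≡⟨ sumSubsets-cong M (λ s → sumℚ-*ʳ (weight β s) (λ t → ind (t ⊆ᵇ s ∧ isEven t)) (allSubsets M)) ⟩
    sumSubsets M (λ s → evenCount s * weight β s) ∎
    where
    open ≡-Reasoning
    M : ℕ
    M = nE G
    expand : ∀ t → β ^ card t * ind (isEven t) ≡ sumSubsets M λ s → ind (t ⊆ᵇ s ∧ isEven t) * weight β s
    expand t = begin
      β ^ card t * ind (isEven t)
        ≡⟨ cong (_* ind (isEven t)) (supersets-weight β t) ⟨
      sumSubsets M (λ s → ind (t ⊆ᵇ s) * weight β s) * ind (isEven t)
        ≡⟨ sumℚ-*ʳ (ind (isEven t)) (λ s → ind (t ⊆ᵇ s) * weight β s) (allSubsets M) ⟨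
      sumSubsets M (λ s → ind (t ⊆ᵇ s) * weight β s * ind (isEven t))
        ≡⟨ sumSubsets-cong M (λ s → trans (swap (ind (t ⊆ᵇ s)) (weight β s) (ind (isEven t)))
                                          (cong (_* weight β s) (sym (ind-∧ (t ⊆ᵇ s) (isEven t))))) ⟩
      sumSubsets M (λ s → ind (t ⊆ᵇ s ∧ isEven t) * weight β s) ∎
      where
      swap : ∀ a w b → a * w * b ≡ a * b * w
      swap = ℚ-Solver.solve-∀ ℚ-ring

  module _ (β : ℚ) .{{_ : NonZero β}} .{{_ : NonZero (1ℚ - β)}} where

    β*[1/β-1] : β * (1/ β - 1ℚ) ≡ 1ℚ - β
    β*[1/β-1] = trans (distrib β (1/ β)) (cong (_- β) (QP.*-inverseʳ β))
      where
      distrib : ∀ b i → b * (i - 1ℚ) ≡ b * i - b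
      distrib = ℚ-Solver.solve-∀ ℚ-ring

    [1-β]*[y-1] : (1ℚ - β) * ((1ℚ + β) ÷ (1ℚ - β) - 1ℚ) ≡ two * β
    [1-β]*[y-1] = trans (distrib β (1/ (1ℚ - β)))
      (trans (cong (λ u → (1ℚ + β) * u - (1ℚ - β)) (QP.*-inverseʳ (1ℚ - β))) (simplify β))
      where
      distrib : ∀ b i → (1ℚ - b) * ((1ℚ + b) * i - 1ℚ) ≡ (1ℚ + b) * ((1ℚ - b) * i) - (1ℚ - b)
      distrib = ℚ-Solver.solve-∀ ℚ-ring
      simplify : ∀ b → (1ℚ + b) * 1ℚ - (1ℚ - b) ≡ two * b
      simplify = ℚ-Solver.solve-∀ ℚ-ring

    module _ (s : EdgeSet G) where
      open EvenCountByNullity (evenCountByNullity s) renaming (nullity to n)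
      open GapsToFull (gapsToFull s) renaming (rankGap to A; nullityGap to N)

      term : evenCount s * weight β s
             ≡ (1ℚ - β) ^ nG G * β ^ rG G * ((1/ β - 1ℚ) ^ (rG G ∸ rk G s) * ((1ℚ + β) ÷ (1ℚ - β) - 1ℚ) ^ nul G s)
      term with exponents {c = card s} {cᶜ = card (Vec.map not s)} (ℕP.m+[n∸m]≡n (count-≤ (isLeast G s)))
                  rank-nullity rankGap≡ nullityGap≡ (trans (card-complement s) (sym (card-replicate (nE G) true)))
      ... | c≡ , cᶜ≡ , nul≡ , nG≡ , rG≡ = begin
        evenCount s * weight β s
          ≡⟨ cong (_* weight β s) evenCount≡ ⟩
        two ^ n * (β ^ card s * (1ℚ - β) ^ card (Vec.map not s))
          ≡⟨ cong₂ (λ u v → two ^ n * (β ^ u * (1ℚ - β) ^ v)) c≡ cᶜ≡ ⟩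
        two ^ n * (β ^ (r ℕ.+ n) * (1ℚ - β) ^ (A ℕ.+ N))
          ≡⟨ weight-identity β (1/ β) y β*[1/β-1] [1-β]*[y-1] r n A N ⟩
        (1ℚ - β) ^ (n ℕ.+ N) * β ^ (A ℕ.+ r) * ((1/ β - 1ℚ) ^ A * (y - 1ℚ) ^ n)
          ≡⟨ cong₂ (λ a b → (1ℚ - β) ^ a * β ^ b * ((1/ β - 1ℚ) ^ A * (y - 1ℚ) ^ n)) nG≡ rG≡ ⟨
        (1ℚ - β) ^ nG G * β ^ rG G * ((1/ β - 1ℚ) ^ A * (y - 1ℚ) ^ n)
          ≡⟨ cong₂ (λ a b → (1ℚ - β) ^ nG G * β ^ rG G * ((1/ β - 1ℚ) ^ a * (y - 1ℚ) ^ b)) rankGap≡′ nul≡ ⟨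
        (1ℚ - β) ^ nG G * β ^ rG G * ((1/ β - 1ℚ) ^ (rG G ∸ rk G s) * (y - 1ℚ) ^ nul G s) ∎
        where
        open ≡-Reasoning
        y : ℚ
        y = (1ℚ + β) ÷ (1ℚ - β)
        r : ℕ
        r = rk G s
        rankGap≡′ : rG G ∸ r ≡ A
        rankGap≡′ = trans (cong (_∸ r) rG≡) (ℕP.m+n∸n≡m A r)

proposition7p9 : (G : Multigraph) (β : ℚ) .{{nzβ : NonZero β}} .{{nz1β : NonZero (1ℚ - β)}} →
    θ G β 0ℚ ≡ ((1ℚ - β) ^ nG G) * (β ^ rG G) * T G (1/ β) ((1ℚ + β) ÷ (1ℚ - β))
proposition7p9 G β = begin
  θ G β 0ℚ
    ≡⟨ θ-at-zero β ⟩
  sumSubsets (nE G) (λ t → β ^ card t * ind (isEven t))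
    ≡⟨ even-expansion β ⟩
  sumSubsets (nE G) (λ s → evenCount s * weight β s)
    ≡⟨ sumSubsets-cong (nE G) (term β) ⟩
  sumSubsets (nE G) (λ s → (1ℚ - β) ^ nG G * β ^ rG G * tutteTerm s)
    ≡⟨ sumℚ-*ˡ ((1ℚ - β) ^ nG G * β ^ rG G) tutteTerm (allSubsets (nE G)) ⟩
  (1ℚ - β) ^ nG G * β ^ rG G * T G (1/ β) ((1ℚ + β) ÷ (1ℚ - β)) ∎
  where
  open ≡-Reasoning
  open Expansion G
  open EvenSubgraphs G
  open EvenSubgraphCount G
  tutteTerm : EdgeSet G → ℚ
  tutteTerm s = (1/ β - 1ℚ) ^ (rG G ∸ rk G s) * ((1ℚ + β) ÷ (1ℚ - β) - 1ℚ) ^ nul G s
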